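{- Let $N\ge1$, $G\subseteq GL_2(\mathbb{Z}/N\mathbb{Z})$ a subgroup, $\Gamma=\Gamma_G$, and let $n$ be a positive integer with $n\bmod N\in\det(G)$. Fix $\delta_n\in G$ with $\det(\delta_n)=n$ and a section $s:G_0\backslash SL_2(\mathbb{Z}/N\mathbb{Z})\to SL_2(\mathbb{Z})$ of the map $\pi(g)=G_0\lambda_N(g)$. Let $\Delta_n=\{\alpha\in M_2(\mathbb{Z}):\det\alpha=n,\ \lambda_N(\alpha)\in G\}$ and define $\phi_n:M_2(\mathbb{Z})_n\to SL_2(\mathbb{Z})$ by $\phi_n(\alpha)=s(G_0\cdot n^{ -1}\delta_n\lambda_N(\alpha))$. Then $(\Delta_n,\phi_n)$ is a Merel pair for $\Gamma_G$.
   Context: $\lambda_N$ is reduction mod $N$; $G_0=G\cap SL_2(\mathbb{Z}/N\mathbb{Z})$; $\Gamma_G=\{\gamma\in SL_2(\mathbb{Z}):\lambda_N(\gamma)\in G_0\}$; $M_2(\mathbb{Z})_n$ is the set of integer matrices of determinant $n$; $n^{ -1}$ denotes the inverse of $n$ in $(\mathbb{Z}/N\mathbb{Z})^\times$. Definition: Let $\Delta\subseteq GL_2(\mathbb{Q})$ with $\Gamma\Delta=\Delta\Gamma$ and $\Gamma\backslash\Delta$ finite; set $\tilde\Delta=\{g\in GL_2(\mathbb{Q}):\tilde g:=\det(g)g^{ -1}\in\Delta\}$. Let $\phi:\tilde\Delta\cdot SL_2(\mathbb{Z})\to SL_2(\mathbb{Z})$ be a map such that (1) $\Gamma\phi(\gamma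 g)=\Gamma\phi(\gamma)g$ for all $\gamma\in\tilde\Delta SL_2(\mathbb{Z})$, $g\in SL_2(\mathbb{Z})$; (2) $\gamma\phi(\gamma)^{ -1}\in\tilde\Delta$ for all $\gamma\in\tilde\Delta SL_2(\mathbb{Z})$; (3) the map $\Gamma\backslash\Delta\to\tilde\Delta SL_2(\mathbb{Z})/SL_2(\mathbb{Z})$, $\Gamma\delta\mapsto\tilde\delta SL_2(\mathbb{Z})$, is injective. Then $(\Delta,\phi)$ is called a Merel pair for $\Gamma$. (Here $\phi_n$ is restricted to $\tilde\Delta_n SL_2(\mathbb{Z})\subseteq M_2(\mathbb{Z})_n$.) -}

module Defs where

open import Data.Nat as ℕ using (ℕ)
open import Data.Integer using (ℤ; +_; _+_; _-_; _*_; -_)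
open import Data.Integer.Divisibility using (_∣_)
open import Data.Product using (Σ; _×_; ∃; ∃-syntax)
open import Data.List using (List)
open import Data.List.Membership.Propositional using (_∈_)
open import Relation.Binary.PropositionalEquality using (_≡_)
open import Relation.Nullary using (¬_)

record Mat : Set where
  constructor mat
  field
    a b c d : ℤ
open Mat public

infixl 7 _⊗_
_⊗_ : Mat → Mat → Mat
mat a₁ b₁ c₁ d₁ ⊗ mat a₂ b₂ c₂ d₂ =
  mat (a₁ * a₂ + b₁ * c₂) (a₁ * b₂ + b₁ * d₂)
      (c₁ * a₂ + d₁ * c₂) (c₁ * b₂ + d₁ * d₂)

det : Mat → ℤ
det (mat a b c d) = a * d - b * c

-- adjugate:  adj g = det(g) g⁻¹  (this is the paper's  g ↦ g̃)
adj : Mat → Mat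
adj (mat a b c d) = mat d (- b) (- c) a

scale : ℤ → Mat → Mat
scale k (mat a b c d) = mat (k * a) (k * b) (k * c) (k * d)

I₂ : Mat
I₂ = mat (+ 1) (+ 0) (+ 0) (+ 1)

-- Congruence mod N  (this models reduction λ_N : equality of images)

infix 4 _≡[_]_ _≡M[_]_
_≡[_]_ : ℤ → ℕ → ℤ → Set
x ≡[ N ] y = (+ N) ∣ (x - y)

_≡M[_]_ : Mat → ℕ → Mat → Set
A ≡M[ N ] B = (a A ≡[ N ] a B) × (b A ≡[ N ] b B)
            × (c A ≡[ N ] c B) × (d A ≡[ N ] d B)

-- A subgroup G ⊆ GL₂(ℤ/Nℤ), given as the predicate on integer matrices
-- "λ_N(A) ∈ G" (hence required to depend only on A mod N).

record IsSubgroupGL2 (N : ℕ) (G : Mat → Set) : Set where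
  field
    respects : ∀ {A B} → A ≡M[ N ] B → G A → G B
    invertible : ∀ {A} → G A → ∃[ u ] (det A * u ≡[ N ] + 1)
    has-one : G I₂
    closed-mul : ∀ {A B} → G A → G B → G (A ⊗ B)
    closed-inv : ∀ {A} → G A → ∃[ B ] (G B × (A ⊗ B) ≡M[ N ] I₂)

SL2Z : Mat → Set
SL2Z g = det g ≡ + 1

SLN : ℕ → Mat → Set
SLN N x = det x ≡[ N ] + 1

G₀ : ℕ → (Mat → Set) → Mat → Set
G₀ N G x = G x × SLN N x

ΓG : ℕ → (Mat → Set) → Mat → Set
ΓG N G γ = SL2Z γ × G₀ N G γ

SameCoset : ℕ → (Mat → Set) → Mat → Mat → Set
SameCoset N G x y = ∃[ g ] (G₀ N G g × x ≡M[ N ] (g ⊗ y))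

-- s : G₀\SL₂(ℤ/Nℤ) → SL₂(ℤ) is a section of π(g) = G₀ λ_N(g).
-- s is given on representatives x ∈ M₂(ℤ) of elements of SL₂(ℤ/Nℤ)
-- and must be constant on G₀-cosets.
record IsSection (N : ℕ) (G : Mat → Set) (s : Mat → Mat) : Set where
  field
    well-defined : ∀ x y → SLN N x → SLN N y → SameCoset N G x y → s x ≡ s y
    into-SL2Z : ∀ x → SLN N x → SL2Z (s x)
    section : ∀ x → SLN N x → SameCoset N G (s x) x

Δn : ℕ → (Mat → Set) → ℕ → Mat → Set
Δn N G n α = det α ≡ + n × G α

-- φ_n(α) = s(G₀ · n⁻¹ δ_n λ_N(α)),  ninv a representative of n⁻¹ mod N
φn : (Mat → Mat) → Mat → ℤ → Mat → Mat
φn s δ ninv α = s (scale ninv (δ ⊗ α))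

-- Merel pairs, for Δ consisting of integer matrices (then Δ̃ consists
-- of integer matrices too, since adj (adj g) = g), and Γ ⊆ SL₂(ℤ).

Δ~ : (Mat → Set) → Mat → Set
Δ~ Δ g = Δ (adj g)

InΔ~SL : (Mat → Set) → Mat → Set
InΔ~SL Δ γ = ∃[ x ] ∃[ g ] (Δ~ Δ x × SL2Z g × γ ≡ x ⊗ g)

record MerelPair (Γ : Mat → Set) (Δ : Mat → Set) (φ : Mat → Mat) : Set where
  field
    Δ-invertible : ∀ δ → Δ δ → ¬ (det δ ≡ + 0)
    ΓΔ⊆ΔΓ : ∀ γ δ → Γ γ → Δ δ → ∃[ δ' ] ∃[ γ' ] (Δ δ' × Γ γ' × γ ⊗ δ ≡ δ' ⊗ γ')
    ΔΓ⊆ΓΔ : ∀ δ γ → Δ δ → Γ γ → ∃[ γ' ] ∃[ δ' ] (Γ γ' × Δ δ' × δ ⊗ γ ≡ γ' ⊗ δ')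
    finite : ∃[ L ] ((∀ δ → δ ∈ L → Δ δ)
                    × (∀ δ → Δ δ → ∃[ γ ] ∃[ δ' ] (Γ γ × δ' ∈ L × δ ≡ γ ⊗ δ')))
    φ-SL2Z : ∀ γ → InΔ~SL Δ γ → SL2Z (φ γ)
    cond1 : ∀ γ g → InΔ~SL Δ γ → SL2Z g →
            ∃[ h ] (Γ h × φ (γ ⊗ g) ≡ h ⊗ (φ γ ⊗ g))
    -- (2)  γ φ(γ)⁻¹ ∈ Δ̃   (φ(γ)⁻¹ = adj φ(γ) since det φ(γ) = 1)
    cond2 : ∀ γ → InΔ~SL Δ γ → Δ~ Δ (γ ⊗ adj (φ γ))
    -- (3)  Γδ ↦ δ̃ SL₂(ℤ) is injective
    cond3 : ∀ δ δ' → Δ δ → Δ δ' →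
            (∃[ g ] (SL2Z g × adj δ' ≡ adj δ ⊗ g)) →
            ∃[ h ] (Γ h × δ' ≡ h ⊗ δ)

-- Write ≈ for congruence mod N and adj A = det(A) A⁻¹. As s(x) lies in the coset G₀x, the
-- matrix s(x) adj(x) is in G₀ for every x ∈ SL₂(ℤ/N). With Y = n⁻¹δₙγ this gives
-- φ(γg) adj(φ(γ)g) ≈ [s(Yg) adj(Yg)] adj[s(Y) adj(Y)] ∈ G₀, which is condition (1), and
-- φ(γ) adj(γ) ≈ [s(Y) adj(Y)] δₙ ∈ G, which is condition (2); condition (3) and ΓΔ = ΔΓ are direct.
-- For finiteness of Γ\Δ, the Hermite normal form writes δ ∈ Δ as σH with σ ∈ SL₂(ℤ) and H upper
-- triangular with entries in [0, n]. If x is σ reduced mod N, then δ = (σ adj s(x)) (s(x) H) with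
-- σ adj s(x) ∈ Γ, so the finitely many s(x)H that lie in Δ represent all cosets. They can be
-- selected because G₀ is decidable: s is injective on cosets, so x ∈ G₀ iff s(x) = s(1).

module Submission where

open import Defs
open import Data.Nat as ℕ using (ℕ; suc; _≤_)
import Data.Nat.Divisibility as ℕ
import Data.Nat.Properties as NP
open import Data.List using (List; upTo; cartesianProduct; cartesianProductWith; filter)
open import Data.List.Membership.Propositional using (_∈_)
open import Data.List.Membership.Propositional.Properties
  using (∈-upTo⁺; ∈-cartesianProduct⁺; ∈-cartesianProductWith⁺; ∈-filter⁺; ∈-filter⁻)
open import Data.Integer using (ℤ; +_; +[1+_]; -[1+_]; _*_; _+_; _-_; -_; ∣_∣; NonZero)
open import Data.Integer.DivMod using (_/_; _%_; _/ℕ_; _%ℕ_; a≡a%n+[a/n]*n; a≡a%ℕn+[a/ℕn]*n; n%d<d; n%ℕd<d)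
import Data.Integer.Properties as ℤ
import Data.Integer.Divisibility.Signed as Signed
open import Data.Integer.Tactic.RingSolver using (solve-∀)
open import Data.Product using (_×_; _,_; ∃-syntax; proj₁; proj₂)
open import Function using (_∘_)
open import Relation.Binary.Bundles using (Setoid)
open import Relation.Binary.Structures using (IsEquivalence)
open import Relation.Binary.Definitions using (DecidableEquality; Decidable)
open import Relation.Nullary.Decidable using (Dec; yes; no; map′; _×-dec_)
open import Relation.Binary.PropositionalEquality
import Relation.Binary.Reasoning.Setoid

-- Integer 2 × 2 matrices

mat-cong : ∀ {a₁ b₁ c₁ d₁ a₂ b₂ c₂ d₂} → a₁ ≡ a₂ → b₁ ≡ b₂ → c₁ ≡ c₂ → d₁ ≡ d₂ →
           mat a₁ b₁ c₁ d₁ ≡ mat a₂ b₂ c₂ d₂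
mat-cong refl refl refl refl = refl

⊗-assoc : ∀ A B C → (A ⊗ B) ⊗ C ≡ A ⊗ (B ⊗ C)
⊗-assoc (mat a b c d) (mat e f g h) (mat i j k l) =
  mat-cong (entry a b e f g h i k) (entry a b e f g h j l) (entry c d e f g h i k) (entry c d e f g h j l)
  where
  entry : ∀ a b e f g h i k → (a * e + b * g) * i + (a * f + b * h) * k ≡ a * (e * i + f * k) + b * (g * i + h * k)
  entry = solve-∀

⊗-identityˡ : ∀ A → I₂ ⊗ A ≡ A
⊗-identityˡ (mat a b c d) = mat-cong (entry₁ a c) (entry₁ b d) (entry₂ a c) (entry₂ b d)
  where
  entry₁ : ∀ x y → + 1 * x + + 0 * y ≡ x
  entry₁ = solve-∀
  entry₂ : ∀ x y → + 0 * x + + 1 * y ≡ y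
  entry₂ = solve-∀

⊗-identityʳ : ∀ A → A ⊗ I₂ ≡ A
⊗-identityʳ (mat a b c d) = mat-cong (entry₁ a b) (entry₂ a b) (entry₁ c d) (entry₂ c d)
  where
  entry₁ : ∀ x y → x * + 1 + y * + 0 ≡ x
  entry₁ = solve-∀
  entry₂ : ∀ x y → x * + 0 + y * + 1 ≡ y
  entry₂ = solve-∀

adj-involutive : ∀ A → adj (adj A) ≡ A
adj-involutive (mat a b c d) = mat-cong refl (ℤ.neg-involutive b) (ℤ.neg-involutive c) refl

adj-⊗ : ∀ A B → adj (A ⊗ B) ≡ adj B ⊗ adj A
adj-⊗ (mat a b c d) (mat e f g h) = mat-cong (entry₁ c d f h) (entry₂ a b f h) (entry₃ c d e g) (entry₄ a b e g)
  where
  entry₁ : ∀ x y u v → x * u + y * v ≡ v * y + (- u) * (- x)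
  entry₁ = solve-∀
  entry₂ : ∀ x y u v → - (x * u + y * v) ≡ v * (- y) + (- u) * x
  entry₂ = solve-∀
  entry₃ : ∀ x y u v → - (x * u + y * v) ≡ (- v) * y + u * (- x)
  entry₃ = solve-∀
  entry₄ : ∀ x y u v → x * u + y * v ≡ (- v) * (- y) + u * x
  entry₄ = solve-∀

scale-⊗ˡ : ∀ k A B → scale k A ⊗ B ≡ scale k (A ⊗ B)
scale-⊗ˡ k (mat a b c d) (mat e f g h) =
  mat-cong (entry k a b e g) (entry k a b f h) (entry k c d e g) (entry k c d f h)
  where
  entry : ∀ k x y u v → (k * x) * u + (k * y) * v ≡ k * (x * u + y * v)
  entry = solve-∀

scale-⊗ʳ : ∀ k A B → A ⊗ scale k B ≡ scale k (A ⊗ B)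
scale-⊗ʳ k (mat a b c d) (mat e f g h) =
  mat-cong (entry k a b e g) (entry k a b f h) (entry k c d e g) (entry k c d f h)
  where
  entry : ∀ k x y u v → x * (k * u) + y * (k * v) ≡ k * (x * u + y * v)
  entry = solve-∀

scale-identity : ∀ A → scale (+ 1) A ≡ A
scale-identity (mat a b c d) = mat-cong (ℤ.*-identityˡ a) (ℤ.*-identityˡ b) (ℤ.*-identityˡ c) (ℤ.*-identityˡ d)

scale-scale : ∀ k l A → scale k (scale l A) ≡ scale (k * l) A
scale-scale k l (mat a b c d) =
  mat-cong (sym (ℤ.*-assoc k l a)) (sym (ℤ.*-assoc k l b)) (sym (ℤ.*-assoc k l c)) (sym (ℤ.*-assoc k l d))

adj-inverseˡ : ∀ A B → adj A ⊗ (A ⊗ B) ≡ scale (det A) B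
adj-inverseˡ (mat a b c d) (mat e f g h) =
  mat-cong (entry₁ a b c d e g) (entry₁ a b c d f h) (entry₂ a b c d e g) (entry₂ a b c d f h)
  where
  entry₁ : ∀ a b c d u v → d * (a * u + b * v) + (- b) * (c * u + d * v) ≡ (a * d - b * c) * u
  entry₁ = solve-∀
  entry₂ : ∀ a b c d u v → (- c) * (a * u + b * v) + a * (c * u + d * v) ≡ (a * d - b * c) * v
  entry₂ = solve-∀

adj-inverseʳ : ∀ A B → (B ⊗ A) ⊗ adj A ≡ scale (det A) B
adj-inverseʳ (mat a b c d) (mat e f g h) =
  mat-cong (entry₁ a b c d e f) (entry₂ a b c d e f) (entry₁ a b c d g h) (entry₂ a b c d g h)
  where
  entry₁ : ∀ a b c d u v → (u * a + v * c) * d + (u * b + v * d) * (- c) ≡ (a * d - b * c) * u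
  entry₁ = solve-∀
  entry₂ : ∀ a b c d u v → (u * a + v * c) * (- b) + (u * b + v * d) * a ≡ (a * d - b * c) * v
  entry₂ = solve-∀

det-⊗ : ∀ A B → det (A ⊗ B) ≡ det A * det B
det-⊗ (mat a b c d) (mat e f g h) = identity a b c d e f g h
  where
  identity : ∀ a b c d e f g h →
    (a * e + b * g) * (c * f + d * h) - (a * f + b * h) * (c * e + d * g) ≡ (a * d - b * c) * (e * h - f * g)
  identity = solve-∀

det-adj : ∀ A → det (adj A) ≡ det A
det-adj (mat a b c d) = identity a b c d
  where
  identity : ∀ a b c d → d * a - (- b) * (- c) ≡ a * d - b * c
  identity = solve-∀

det-scale : ∀ k A → det (scale k A) ≡ k * k * det A
det-scale k (mat a b c d) = identity k a b c d
  where
  identity : ∀ k a b c d → (k * a) * (k * d) - (k * b) * (k * c) ≡ k * k * (a * d - b * c)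
  identity = solve-∀

adj-sandwich : ∀ X Y Z → (X ⊗ adj Y) ⊗ (Y ⊗ Z) ≡ scale (det Y) (X ⊗ Z)
adj-sandwich X Y Z = begin
  (X ⊗ adj Y) ⊗ (Y ⊗ Z)    ≡⟨ ⊗-assoc X (adj Y) (Y ⊗ Z) ⟩
  X ⊗ (adj Y ⊗ (Y ⊗ Z))    ≡⟨ cong (X ⊗_) (adj-inverseˡ Y Z) ⟩
  X ⊗ scale (det Y) Z      ≡⟨ scale-⊗ʳ (det Y) X Z ⟩
  scale (det Y) (X ⊗ Z)    ∎
  where open ≡-Reasoning

⊗-adj-cancelʳ : ∀ X {M} → SL2Z M → (X ⊗ adj M) ⊗ M ≡ X
⊗-adj-cancelʳ X {M} detM≡1 = begin
  (X ⊗ adj M) ⊗ M              ≡⟨ cong ((X ⊗ adj M) ⊗_) (sym (adj-involutive M)) ⟩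
  (X ⊗ adj M) ⊗ adj (adj M)    ≡⟨ adj-inverseʳ (adj M) X ⟩
  scale (det (adj M)) X        ≡⟨ cong (λ k → scale k X) (trans (det-adj M) detM≡1) ⟩
  scale (+ 1) X                ≡⟨ scale-identity X ⟩
  X                            ∎
  where open ≡-Reasoning

adj-⊗-adj : ∀ A B → adj (A ⊗ adj B) ≡ B ⊗ adj A
adj-⊗-adj A B = trans (adj-⊗ A (adj B)) (cong (_⊗ adj A) (adj-involutive B))

adj-sandwich′ : ∀ P Q X g → (P ⊗ adj (X ⊗ g)) ⊗ adj (Q ⊗ adj X) ≡ scale (det X) (P ⊗ adj (Q ⊗ g))
adj-sandwich′ P Q X g = begin
  (P ⊗ adj (X ⊗ g)) ⊗ adj (Q ⊗ adj X)      ≡⟨ cong₂ (λ u v → (P ⊗ u) ⊗ v) (adj-⊗ X g) (adj-⊗-adj Q X) ⟩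
  (P ⊗ (adj g ⊗ adj X)) ⊗ (X ⊗ adj Q)      ≡⟨ cong (_⊗ (X ⊗ adj Q)) (sym (⊗-assoc P (adj g) (adj X))) ⟩
  ((P ⊗ adj g) ⊗ adj X) ⊗ (X ⊗ adj Q)      ≡⟨ adj-sandwich (P ⊗ adj g) X (adj Q) ⟩
  scale (det X) ((P ⊗ adj g) ⊗ adj Q)      ≡⟨ cong (scale (det X)) (⊗-assoc P (adj g) (adj Q)) ⟩
  scale (det X) (P ⊗ (adj g ⊗ adj Q))      ≡⟨ cong (λ M → scale (det X) (P ⊗ M)) (sym (adj-⊗ Q g)) ⟩
  scale (det X) (P ⊗ adj (Q ⊗ g))          ∎
  where open ≡-Reasoning

infix 4 _≟ᴹ_
_≟ᴹ_ : DecidableEquality Mat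
mat a b c d ≟ᴹ mat a' b' c' d' =
  map′ (λ (a≡a' , b≡b' , c≡c' , d≡d') → mat-cong a≡a' b≡b' c≡c' d≡d')
       (λ A≡A' → cong Mat.a A≡A' , cong Mat.b A≡A' , cong Mat.c A≡A' , cong Mat.d A≡A')
       (a ℤ.≟ a' ×-dec b ℤ.≟ b' ×-dec c ℤ.≟ c' ×-dec d ℤ.≟ d')

det-⊗-SL2Zˡ : ∀ g A → SL2Z g → det (g ⊗ A) ≡ det A
det-⊗-SL2Zˡ g A detg≡1 = trans (det-⊗ g A) (trans (cong (_* det A) detg≡1) (ℤ.*-identityˡ (det A)))

det-⊗-SL2Zʳ : ∀ A g → SL2Z g → det (A ⊗ g) ≡ det A
det-⊗-SL2Zʳ A g detg≡1 = trans (det-⊗ A g) (trans (cong (det A *_) detg≡1) (ℤ.*-identityʳ (det A)))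

SL2Z-⊗ : ∀ A B → SL2Z A → SL2Z B → SL2Z (A ⊗ B)
SL2Z-⊗ A B detA≡1 detB≡1 = trans (det-⊗ A B) (cong₂ _*_ detA≡1 detB≡1)

SL2Z-adj : ∀ A → SL2Z A → SL2Z (adj A)
SL2Z-adj A detA≡1 = trans (det-adj A) detA≡1

module Congruence (N : ℕ) where

  infix 4 _≈_ _≈ᴹ_ _≈?_

  record _≈_ (x y : ℤ) : Set where
    constructor ⟦_⟧
    field congruent : x ≡[ N ] y
  open _≈_ public

  private
    fromSigned : ∀ {x y} → + N Signed.∣ x - y → x ≈ y
    fromSigned = ⟦_⟧ ∘ Signed.∣⇒∣ᵤ

    toSigned : ∀ {x y} → x ≈ y → + N Signed.∣ x - y
    toSigned = Signed.∣ᵤ⇒∣ ∘ congruent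

    divides-by : ∀ {u v} → u ≡ v → + N Signed.∣ v → + N Signed.∣ u
    divides-by u≡v = subst (+ N Signed.∣_) (sym u≡v)

  ≈-reflexive : ∀ {x y} → x ≡ y → x ≈ y
  ≈-reflexive {x} refl = fromSigned (Signed.divides (+ 0) (ℤ.+-inverseʳ x))

  ≈-refl : ∀ {x} → x ≈ x
  ≈-refl = ≈-reflexive refl

  ≈-sym : ∀ {x y} → x ≈ y → y ≈ x
  ≈-sym {x} {y} x≈y = fromSigned (divides-by (identity x y) (Signed.∣m⇒∣-m (toSigned x≈y)))
    where
    identity : ∀ x y → y - x ≡ - (x - y)
    identity = solve-∀

  ≈-trans : ∀ {x y z} → x ≈ y → y ≈ z → x ≈ z
  ≈-trans {x} {y} {z} x≈y y≈z =
    fromSigned (divides-by (identity x y z) (Signed.∣m∣n⇒∣m+n (toSigned x≈y) (toSigned y≈z)))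
    where
    identity : ∀ x y z → x - z ≡ (x - y) + (y - z)
    identity = solve-∀

  +-cong : ∀ {x y u v} → x ≈ y → u ≈ v → x + u ≈ y + v
  +-cong {x} {y} {u} {v} x≈y u≈v =
    fromSigned (divides-by (identity x y u v) (Signed.∣m∣n⇒∣m+n (toSigned x≈y) (toSigned u≈v)))
    where
    identity : ∀ x y u v → (x + u) - (y + v) ≡ (x - y) + (u - v)
    identity = solve-∀

  neg-cong : ∀ {x y} → x ≈ y → - x ≈ - y
  neg-cong {x} {y} x≈y = fromSigned (divides-by (identity x y) (Signed.∣m⇒∣-m (toSigned x≈y)))
    where
    identity : ∀ x y → (- x) - (- y) ≡ - (x - y)
    identity = solve-∀

  *-cong : ∀ {x y u v} → x ≈ y → u ≈ v → x * u ≈ y * v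
  *-cong {x} {y} {u} {v} x≈y u≈v = fromSigned (divides-by (identity x y u v)
    (Signed.∣m∣n⇒∣m+n (Signed.∣n⇒∣m*n x (toSigned u≈v)) (Signed.∣m⇒∣m*n v (toSigned x≈y))))
    where
    identity : ∀ x y u v → x * u - y * v ≡ x * (u - v) + (x - y) * v
    identity = solve-∀

  ≈-%ℕ : ∀ x .{{_ : ℕ.NonZero N}} → x ≈ + (x %ℕ N)
  ≈-%ℕ x = fromSigned (Signed.divides (x /ℕ N) (begin
    x - + (x %ℕ N)                               ≡⟨ cong (_- + (x %ℕ N)) (a≡a%ℕn+[a/ℕn]*n x N) ⟩
    (+ (x %ℕ N) + x /ℕ N * + N) - + (x %ℕ N)     ≡⟨ identity (+ (x %ℕ N)) (x /ℕ N) (+ N) ⟩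
    x /ℕ N * + N                                 ∎))
    where
    open ≡-Reasoning
    identity : ∀ r q m → (r + q * m) - r ≡ q * m
    identity = solve-∀

  _≈?_ : Decidable _≈_
  x ≈? y = map′ ⟦_⟧ congruent (N ℕ.∣? ∣ x - y ∣)

  ≈-setoid : Setoid _ _
  ≈-setoid = record
    { Carrier = ℤ
    ; _≈_ = _≈_
    ; isEquivalence = record { refl = ≈-refl ; sym = ≈-sym ; trans = ≈-trans }
    }

  SL2Z⇒SLN : ∀ A → SL2Z A → SLN N A
  SL2Z⇒SLN A = congruent ∘ ≈-reflexive

  record _≈ᴹ_ (A B : Mat) : Set where
    constructor mat≈
    field
      a≈ : a A ≈ a B
      b≈ : b A ≈ b B
      c≈ : c A ≈ c B
      d≈ : d A ≈ d B

  ≈ᴹ⇒≡M : ∀ {A B} → A ≈ᴹ B → A ≡M[ N ] B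
  ≈ᴹ⇒≡M (mat≈ ⟦ p ⟧ ⟦ q ⟧ ⟦ r ⟧ ⟦ t ⟧) = p , q , r , t

  ≡M⇒≈ᴹ : ∀ {A B} → A ≡M[ N ] B → A ≈ᴹ B
  ≡M⇒≈ᴹ (p , q , r , t) = mat≈ ⟦ p ⟧ ⟦ q ⟧ ⟦ r ⟧ ⟦ t ⟧

  ≈ᴹ-isEquivalence : IsEquivalence _≈ᴹ_
  ≈ᴹ-isEquivalence = record
    { refl  = mat≈ ≈-refl ≈-refl ≈-refl ≈-refl
    ; sym   = λ (mat≈ p q r t) → mat≈ (≈-sym p) (≈-sym q) (≈-sym r) (≈-sym t)
    ; trans = λ (mat≈ p q r t) (mat≈ p' q' r' t') →
                mat≈ (≈-trans p p') (≈-trans q q') (≈-trans r r') (≈-trans t t')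
    }

  ≈ᴹ-setoid : Setoid _ _
  ≈ᴹ-setoid = record { Carrier = Mat ; _≈_ = _≈ᴹ_ ; isEquivalence = ≈ᴹ-isEquivalence }

  open IsEquivalence ≈ᴹ-isEquivalence public
    using () renaming (refl to ≈ᴹ-refl; sym to ≈ᴹ-sym; trans to ≈ᴹ-trans; reflexive to ≈ᴹ-reflexive)

  ⊗-cong : ∀ {A A' B B'} → A ≈ᴹ A' → B ≈ᴹ B' → A ⊗ B ≈ᴹ A' ⊗ B'
  ⊗-cong (mat≈ p q r t) (mat≈ p' q' r' t') = mat≈
    (+-cong (*-cong p p') (*-cong q r')) (+-cong (*-cong p q') (*-cong q t'))
    (+-cong (*-cong r p') (*-cong t r')) (+-cong (*-cong r q') (*-cong t t'))

  ⊗-congˡ : ∀ {A A'} C → A ≈ᴹ A' → A ⊗ C ≈ᴹ A' ⊗ C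
  ⊗-congˡ C A≈A' = ⊗-cong A≈A' (≈ᴹ-refl {C})

  ⊗-congʳ : ∀ C {B B'} → B ≈ᴹ B' → C ⊗ B ≈ᴹ C ⊗ B'
  ⊗-congʳ C = ⊗-cong (≈ᴹ-refl {C})

  adj-cong : ∀ {A A'} → A ≈ᴹ A' → adj A ≈ᴹ adj A'
  adj-cong (mat≈ p q r t) = mat≈ t (neg-cong q) (neg-cong r) p

  scale-cong : ∀ {k k' A A'} → k ≈ k' → A ≈ᴹ A' → scale k A ≈ᴹ scale k' A'
  scale-cong k≈k' (mat≈ p q r t) = mat≈ (*-cong k≈k' p) (*-cong k≈k' q) (*-cong k≈k' r) (*-cong k≈k' t)

  det-cong : ∀ {A A'} → A ≈ᴹ A' → det A ≈ det A'
  det-cong (mat≈ p q r t) = +-cong (*-cong p t) (neg-cong (*-cong q r))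

  scale-≈-identity : ∀ k A → k ≈ + 1 → scale k A ≈ᴹ A
  scale-≈-identity k A k≈1 = ≈ᴹ-trans (scale-cong k≈1 ≈ᴹ-refl) (≈ᴹ-reflexive (scale-identity A))

module Subgroup {N : ℕ} {G : Mat → Set} (G-subgroup : IsSubgroupGL2 N G) where
  open Congruence N
  open IsSubgroupGL2 G-subgroup

  G-resp : ∀ {A B} → A ≈ᴹ B → G A → G B
  G-resp = respects ∘ ≈ᴹ⇒≡M

  G₀-resp : ∀ {A B} → A ≈ᴹ B → G₀ N G A → G₀ N G B
  G₀-resp A≈B (GA , detA≈1) = G-resp A≈B GA , congruent (≈-trans (≈-sym (det-cong A≈B)) ⟦ detA≈1 ⟧)

  G-cancelʳ : ∀ {A B} → G B → G (A ⊗ B) → G A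
  G-cancelʳ {A} {B} GB GAB with closed-inv GB
  ... | B⁻¹ , GB⁻¹ , BB⁻¹≡I = G-resp AB·B⁻¹≈A (closed-mul GAB GB⁻¹)
    where
    open Relation.Binary.Reasoning.Setoid ≈ᴹ-setoid
    AB·B⁻¹≈A : (A ⊗ B) ⊗ B⁻¹ ≈ᴹ A
    AB·B⁻¹≈A = begin
      (A ⊗ B) ⊗ B⁻¹  ≡⟨ ⊗-assoc A B B⁻¹ ⟩
      A ⊗ (B ⊗ B⁻¹)  ≈⟨ ⊗-congʳ A (≡M⇒≈ᴹ {B ⊗ B⁻¹} BB⁻¹≡I) ⟩
      A ⊗ I₂         ≡⟨ ⊗-identityʳ A ⟩
      A              ∎

  G₀-adj : ∀ {A} → G₀ N G A → G₀ N G (adj A)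
  G₀-adj {A} (GA , detA≈1) = G-cancelʳ GA (G-resp (≈ᴹ-sym adjA·A≈I) has-one) , detAdj≈1
    where
    adjA·A≈I : adj A ⊗ A ≈ᴹ I₂
    adjA·A≈I = ≈ᴹ-trans (≈ᴹ-reflexive (trans (cong (adj A ⊗_) (sym (⊗-identityʳ A))) (adj-inverseˡ A I₂)))
                        (scale-≈-identity (det A) I₂ ⟦ detA≈1 ⟧)
    detAdj≈1 : SLN N (adj A)
    detAdj≈1 = congruent (≈-trans (≈-reflexive (det-adj A)) ⟦ detA≈1 ⟧)

module Section {N : ℕ} {G : Mat → Set} (G-subgroup : IsSubgroupGL2 N G)
               {s : Mat → Mat} (s-section : IsSection N G s) where
  open Congruence N
  open Subgroup G-subgroup
  open IsSubgroupGL2 G-subgroup using (closed-mul)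
  open IsSection s-section

  s⊗adj∈G₀ : ∀ {x} → SLN N x → G₀ N G (s x ⊗ adj x)
  s⊗adj∈G₀ {x} x∈SL with section x x∈SL
  ... | g , g∈G₀ , sx≡gx = G₀-resp (≈ᴹ-sym sx·adjx≈g) g∈G₀
    where
    open Relation.Binary.Reasoning.Setoid ≈ᴹ-setoid
    sx·adjx≈g : s x ⊗ adj x ≈ᴹ g
    sx·adjx≈g = begin
      s x ⊗ adj x        ≈⟨ ⊗-congˡ (adj x) (≡M⇒≈ᴹ {s x} sx≡gx) ⟩
      (g ⊗ x) ⊗ adj x    ≡⟨ adj-inverseʳ x g ⟩
      scale (det x) g    ≈⟨ scale-≈-identity (det x) g ⟦ x∈SL ⟧ ⟩
      g                  ∎

  -- s is injective on cosets, so G₀ is the fibre of s over the trivial coset.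
  s≡s-I₂⇒G₀ : ∀ {x} → SLN N x → s x ≡ s I₂ → G₀ N G x
  s≡s-I₂⇒G₀ {x} x∈SL sx≡sI = subst G x-factorisation (closed-mul Gx₁ GsI) , x∈SL
    where
    Gx₁ : G (adj (s x ⊗ adj x))
    Gx₁ = proj₁ (G₀-adj (s⊗adj∈G₀ x∈SL))
    GsI : G (s I₂ ⊗ adj I₂)
    GsI = proj₁ (s⊗adj∈G₀ (SL2Z⇒SLN I₂ refl))
    x-factorisation : adj (s x ⊗ adj x) ⊗ (s I₂ ⊗ adj I₂) ≡ x
    x-factorisation = begin
      adj (s x ⊗ adj x) ⊗ (s I₂ ⊗ I₂)          ≡⟨ cong₂ (λ u v → u ⊗ (v ⊗ I₂)) (adj-⊗ (s x) (adj x)) (sym sx≡sI) ⟩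
      (adj (adj x) ⊗ adj (s x)) ⊗ (s x ⊗ I₂)   ≡⟨ adj-sandwich (adj (adj x)) (s x) I₂ ⟩
      scale (det (s x)) (adj (adj x) ⊗ I₂)     ≡⟨ cong₂ scale (into-SL2Z x x∈SL) (⊗-identityʳ (adj (adj x))) ⟩
      scale (+ 1) (adj (adj x))                ≡⟨ scale-identity (adj (adj x)) ⟩
      adj (adj x)                              ≡⟨ adj-involutive x ⟩
      x                                        ∎
      where open ≡-Reasoning

  G₀⇒s≡s-I₂ : ∀ {x} → G₀ N G x → s x ≡ s I₂
  G₀⇒s≡s-I₂ {x} x∈G₀@(_ , x∈SL) =
    well-defined x I₂ x∈SL (SL2Z⇒SLN I₂ refl) (x , x∈G₀ , ≈ᴹ⇒≡M (≈ᴹ-reflexive (sym (⊗-identityʳ x))))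

  G₀? : ∀ x → Dec (G₀ N G x)
  G₀? x = map′ (λ (⟦ x∈SL ⟧ , sx≡sI) → s≡s-I₂⇒G₀ x∈SL sx≡sI) (λ x∈G₀ → ⟦ proj₂ x∈G₀ ⟧ , G₀⇒s≡s-I₂ x∈G₀)
               (det x ≈? + 1 ×-dec s x ≟ᴹ s I₂)

module MerelConditions {N : ℕ} {G : Mat → Set} (G-subgroup : IsSubgroupGL2 N G)
                       {n : ℕ} {δn : Mat} (δn∈G : G δn) (det-δn : det δn ≡[ N ] + n)
                       {ninv : ℤ} (ninv-inverse : + n * ninv ≡[ N ] + 1)
                       {s : Mat → Mat} (s-section : IsSection N G s) where
  open Congruence N
  open Subgroup G-subgroup
  open Section G-subgroup s-section
  open IsSubgroupGL2 G-subgroup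
  open IsSection s-section

  det-δn≈n : det δn ≈ + n
  det-δn≈n = ⟦ det-δn ⟧

  n·ninv≈1 : + n * ninv ≈ + 1
  n·ninv≈1 = ⟦ ninv-inverse ⟧

  Γ Δ : Mat → Set
  Γ = ΓG N G
  Δ = Δn N G n

  φ : Mat → Mat
  φ = φn s δn ninv

  Γ-intro : ∀ γ → SL2Z γ → G γ → Γ γ
  Γ-intro γ detγ≡1 γ∈G = detγ≡1 , γ∈G , SL2Z⇒SLN γ detγ≡1

  det-Δ̃SL : ∀ {γ} → InΔ~SL Δ γ → det γ ≡ + n
  det-Δ̃SL (x , g , (det-adjx≡n , _) , detg≡1 , refl) =
    trans (det-⊗-SL2Zʳ x g detg≡1) (trans (sym (det-adj x)) det-adjx≡n)

  -- n⁻¹ δₙ α in the paper, so that φ α = s (normalise α)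
  normalise : Mat → Mat
  normalise α = scale ninv (δn ⊗ α)

  normalise-⊗ : ∀ α g → normalise (α ⊗ g) ≡ normalise α ⊗ g
  normalise-⊗ α g = trans (cong (scale ninv) (sym (⊗-assoc δn α g))) (sym (scale-⊗ˡ ninv (δn ⊗ α) g))

  det-normalise : ∀ α → det α ≡ + n → det (normalise α) ≈ + 1
  det-normalise α detα≡n = begin
    det (scale ninv (δn ⊗ α))            ≡⟨ trans (det-scale ninv (δn ⊗ α)) (cong (ninv * ninv *_) (det-⊗ δn α)) ⟩
    ninv * ninv * (det δn * det α)       ≈⟨ *-cong (≈-refl {ninv * ninv}) (*-cong det-δn≈n (≈-reflexive detα≡n)) ⟩
    ninv * ninv * (+ n * + n)            ≡⟨ identity ninv (+ n) ⟩
    (+ n * ninv) * (+ n * ninv)          ≈⟨ *-cong n·ninv≈1 n·ninv≈1 ⟩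
    + 1                                  ∎
    where
    open Relation.Binary.Reasoning.Setoid ≈-setoid
    identity : ∀ k m → k * k * (m * m) ≡ (m * k) * (m * k)
    identity = solve-∀

  normalise-⊗-adj : ∀ α → det α ≡ + n → normalise α ⊗ adj α ≈ᴹ δn
  normalise-⊗-adj α detα≡n = begin
    scale ninv (δn ⊗ α) ⊗ adj α          ≡⟨ scale-⊗ˡ ninv (δn ⊗ α) (adj α) ⟩
    scale ninv ((δn ⊗ α) ⊗ adj α)        ≡⟨ cong (scale ninv) (adj-inverseʳ α δn) ⟩
    scale ninv (scale (det α) δn)        ≡⟨ scale-scale ninv (det α) δn ⟩
    scale (ninv * det α) δn              ≡⟨ cong (λ k → scale k δn) ninv·detα≡n·ninv ⟩
    scale (+ n * ninv) δn                ≈⟨ scale-≈-identity (+ n * ninv) δn n·ninv≈1 ⟩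
    δn                                   ∎
    where
    open Relation.Binary.Reasoning.Setoid ≈ᴹ-setoid
    ninv·detα≡n·ninv : ninv * det α ≡ + n * ninv
    ninv·detα≡n·ninv = trans (cong (ninv *_) detα≡n) (ℤ.*-comm ninv (+ n))

  φ-SL2Z : ∀ γ → det γ ≡ + n → SL2Z (φ γ)
  φ-SL2Z γ detγ≡n = into-SL2Z (normalise γ) (congruent (det-normalise γ detγ≡n))

  ΓΔ⊆ΔΓ : ∀ γ δ → Γ γ → Δ δ → ∃[ δ' ] ∃[ γ' ] (Δ δ' × Γ γ' × γ ⊗ δ ≡ δ' ⊗ γ')
  ΓΔ⊆ΔΓ γ δ (detγ≡1 , γ∈G , _) (detδ≡n , δ∈G) =
    γ ⊗ δ , I₂ , (trans (det-⊗-SL2Zˡ γ δ detγ≡1) detδ≡n , closed-mul γ∈G δ∈G) ,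
    Γ-intro I₂ refl has-one , sym (⊗-identityʳ _)

  ΔΓ⊆ΓΔ : ∀ δ γ → Δ δ → Γ γ → ∃[ γ' ] ∃[ δ' ] (Γ γ' × Δ δ' × δ ⊗ γ ≡ γ' ⊗ δ')
  ΔΓ⊆ΓΔ δ γ (detδ≡n , δ∈G) (detγ≡1 , γ∈G , _) =
    I₂ , δ ⊗ γ , Γ-intro I₂ refl has-one ,
    (trans (det-⊗-SL2Zʳ δ γ detγ≡1) detδ≡n , closed-mul δ∈G γ∈G) , sym (⊗-identityˡ _)

  φ-equivariant : ∀ γ g → InΔ~SL Δ γ → SL2Z g → ∃[ h ] (Γ h × φ (γ ⊗ g) ≡ h ⊗ (φ γ ⊗ g))
  φ-equivariant γ g γ∈Δ̃SL detg≡1 =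
    h , Γ-intro h deth≡1 h∈G , sym (⊗-adj-cancelʳ (φ (γ ⊗ g)) φγ⊗g∈SL)
    where
    detγ≡n = det-Δ̃SL γ∈Δ̃SL
    detγg≡n = trans (det-⊗-SL2Zʳ γ g detg≡1) detγ≡n
    Y = normalise γ
    Y∈SL : SLN N Y
    Y∈SL = congruent (det-normalise γ detγ≡n)
    h = φ (γ ⊗ g) ⊗ adj (φ γ ⊗ g)
    φγ⊗g∈SL : SL2Z (φ γ ⊗ g)
    φγ⊗g∈SL = SL2Z-⊗ (φ γ) g (φ-SL2Z γ detγ≡n) detg≡1
    deth≡1 : SL2Z h
    deth≡1 = SL2Z-⊗ (φ (γ ⊗ g)) (adj (φ γ ⊗ g))
                    (φ-SL2Z (γ ⊗ g) detγg≡n) (SL2Z-adj (φ γ ⊗ g) φγ⊗g∈SL)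
    Y⊗g∈SL : SLN N (Y ⊗ g)
    Y⊗g∈SL = subst (SLN N) (normalise-⊗ γ g) (congruent (det-normalise (γ ⊗ g) detγg≡n))
    quotient≈h : s (Y ⊗ g) ⊗ adj (Y ⊗ g) ⊗ adj (s Y ⊗ adj Y) ≈ᴹ h
    quotient≈h = begin
      s (Y ⊗ g) ⊗ adj (Y ⊗ g) ⊗ adj (s Y ⊗ adj Y)    ≡⟨ adj-sandwich′ (s (Y ⊗ g)) (s Y) Y g ⟩
      scale (det Y) (s (Y ⊗ g) ⊗ adj (s Y ⊗ g))      ≈⟨ scale-≈-identity (det Y) _ (det-normalise γ detγ≡n) ⟩
      s (Y ⊗ g) ⊗ adj (s Y ⊗ g)                      ≡⟨ cong (λ A → s A ⊗ adj (s Y ⊗ g)) (sym (normalise-⊗ γ g)) ⟩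
      h                                              ∎
      where open Relation.Binary.Reasoning.Setoid ≈ᴹ-setoid
    h∈G : G h
    h∈G = G-resp quotient≈h
      (closed-mul (proj₁ (s⊗adj∈G₀ Y⊗g∈SL)) (proj₁ (G₀-adj (s⊗adj∈G₀ Y∈SL))))

  γ⊗adjφ∈Δ̃ : ∀ γ → InΔ~SL Δ γ → Δ~ Δ (γ ⊗ adj (φ γ))
  γ⊗adjφ∈Δ̃ γ γ∈Δ̃SL =
    subst Δ (sym (adj-⊗-adj γ (φ γ))) (det≡n , G-resp quotient≈φγ⊗adjγ (closed-mul sY⊗adjY∈G δn∈G))
    where
    detγ≡n = det-Δ̃SL γ∈Δ̃SL
    Y = normalise γ
    det≡n : det (φ γ ⊗ adj γ) ≡ + n
    det≡n = trans (det-⊗-SL2Zˡ (φ γ) (adj γ) (φ-SL2Z γ detγ≡n)) (trans (det-adj γ) detγ≡n)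
    sY⊗adjY∈G : G (s Y ⊗ adj Y)
    sY⊗adjY∈G = proj₁ (s⊗adj∈G₀ (congruent (det-normalise γ detγ≡n)))
    quotient≈φγ⊗adjγ : (s Y ⊗ adj Y) ⊗ δn ≈ᴹ φ γ ⊗ adj γ
    quotient≈φγ⊗adjγ = begin
      (s Y ⊗ adj Y) ⊗ δn               ≈⟨ ⊗-congʳ (s Y ⊗ adj Y) (≈ᴹ-sym (normalise-⊗-adj γ detγ≡n)) ⟩
      (s Y ⊗ adj Y) ⊗ (Y ⊗ adj γ)      ≡⟨ adj-sandwich (s Y) Y (adj γ) ⟩
      scale (det Y) (s Y ⊗ adj γ)      ≈⟨ scale-≈-identity (det Y) (s Y ⊗ adj γ) (det-normalise γ detγ≡n) ⟩
      s Y ⊗ adj γ                      ∎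
      where open Relation.Binary.Reasoning.Setoid ≈ᴹ-setoid

  adj-Γ-injective : ∀ δ δ' → Δ δ → Δ δ' →
                    (∃[ g ] (SL2Z g × adj δ' ≡ adj δ ⊗ g)) → ∃[ h ] (Γ h × δ' ≡ h ⊗ δ)
  adj-Γ-injective δ δ' (_ , δ∈G) (_ , δ'∈G) (g , detg≡1 , adjδ'≡adjδ⊗g) =
    adj g , Γ-intro (adj g) (SL2Z-adj g detg≡1) (G-cancelʳ δ∈G (subst G δ'≡adjg⊗δ δ'∈G)) , δ'≡adjg⊗δ
    where
    δ'≡adjg⊗δ : δ' ≡ adj g ⊗ δ
    δ'≡adjg⊗δ = begin
      δ'                       ≡⟨ sym (adj-involutive δ') ⟩
      adj (adj δ')             ≡⟨ cong adj adjδ'≡adjδ⊗g ⟩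
      adj (adj δ ⊗ g)          ≡⟨ adj-⊗ (adj δ) g ⟩
      adj g ⊗ adj (adj δ)      ≡⟨ cong (adj g ⊗_) (adj-involutive δ) ⟩
      adj g ⊗ δ                ∎
      where open ≡-Reasoning

-- Hermite normal form

box : ℕ → List Mat
box k = cartesianProductWith (λ (x , y) (z , w) → mat (+ x) (+ y) (+ z) (+ w)) pairs pairs
  where
  pairs = cartesianProduct (upTo k) (upTo k)

∈-box : ∀ {k x y z w} → x ℕ.< k → y ℕ.< k → z ℕ.< k → w ℕ.< k → mat (+ x) (+ y) (+ z) (+ w) ∈ box k
∈-box x<k y<k z<k w<k = ∈-cartesianProductWith⁺ (λ (x , y) (z , w) → mat (+ x) (+ y) (+ z) (+ w))
  (∈-cartesianProduct⁺ (∈-upTo⁺ x<k) (∈-upTo⁺ y<k)) (∈-cartesianProduct⁺ (∈-upTo⁺ z<k) (∈-upTo⁺ w<k))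

det-upper : ∀ a b d → det (mat a b (+ 0) d) ≡ a * d
det-upper a b d = identity a b d
  where
  identity : ∀ a b d → a * d - b * + 0 ≡ a * d
  identity = solve-∀

Triangularisable : Mat → Set
Triangularisable A = ∃[ σ ] ∃[ T ] (SL2Z σ × c T ≡ + 0 × A ≡ σ ⊗ T)

-- one Euclidean step on the first column: (a, c) ↦ (c, -(a mod c))
euclid-step : ∀ a b c d .{{_ : NonZero c}} →
              mat a b c d ≡ mat (a / c) (- + 1) (+ 1) (+ 0) ⊗ mat c d (- + (a % c)) (a / c * d - b)
euclid-step a b c d = mat-cong (trans (a≡a%n+[a/n]*n a c) (entry₁ (+ (a % c)) (a / c) c))
                               (entry₂ (a / c) b d) (entry₃ c (+ (a % c))) (entry₄ d (a / c * d - b))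
  where
  entry₁ : ∀ r q c → r + q * c ≡ q * c + (- + 1) * (- r)
  entry₁ = solve-∀
  entry₂ : ∀ q b d → b ≡ q * d + (- + 1) * (q * d - b)
  entry₂ = solve-∀
  entry₃ : ∀ c r → c ≡ + 1 * c + + 0 * (- r)
  entry₃ = solve-∀
  entry₄ : ∀ d x → d ≡ + 1 * d + + 0 * x
  entry₄ = solve-∀

triangularise-step : ∀ {k} a b c d .{{_ : NonZero c}} → ∣ c ∣ ℕ.≤ k →
                     (∀ A → ∣ Mat.c A ∣ ℕ.< k → Triangularisable A) → Triangularisable (mat a b c d)
triangularise-step a b c d |c|≤k triangularise<k
  with triangularise<k (mat c d (- + (a % c)) (a / c * d - b)) remainder<k
  where
  remainder<k = subst (ℕ._< _) (sym (ℤ.∣-i∣≡∣i∣ (+ (a % c)))) (NP.<-≤-trans (n%d<d a c) |c|≤k)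
... | σ , T , detσ≡1 , cT≡0 , A'≡σT =
  E ⊗ σ , T , SL2Z-⊗ E σ (detE≡1 (a / c)) detσ≡1 , cT≡0 ,
  trans (euclid-step a b c d) (trans (cong (E ⊗_) A'≡σT) (sym (⊗-assoc E σ T)))
  where
  E = mat (a / c) (- + 1) (+ 1) (+ 0)
  detE≡1 : ∀ q → q * + 0 - (- + 1) * + 1 ≡ + 1
  detE≡1 = solve-∀

triangularise : ∀ k A → ∣ Mat.c A ∣ ℕ.< k → Triangularisable A
triangularise (suc k) (mat a b (+ 0) d) _ = I₂ , mat a b (+ 0) d , refl , refl , sym (⊗-identityˡ _)
triangularise (suc k) (mat a b c@(+[1+ _ ]) d) (ℕ.s≤s |c|≤k) = triangularise-step a b c d |c|≤k (triangularise k)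
triangularise (suc k) (mat a b c@(-[1+ _ ]) d) (ℕ.s≤s |c|≤k) = triangularise-step a b c d |c|≤k (triangularise k)

PositiveUpperTriangular : ℕ → Mat → Set
PositiveUpperTriangular m A =
  ∃[ σ ] ∃[ i ] ∃[ b ] ∃[ j ] (SL2Z σ × suc i ℕ.* suc j ≡ m × A ≡ σ ⊗ mat (+ suc i) b (+ 0) (+ suc j))

positive-diagonal : ∀ {m} a b d → a * d ≡ + suc m → PositiveUpperTriangular (suc m) (mat a b (+ 0) d)
positive-diagonal (+ 0) b d ()
positive-diagonal a b (+ 0) ad≡1+m with () ← trans (sym (ℤ.*-zeroʳ a)) ad≡1+m
positive-diagonal +[1+ i ] b +[1+ j ] ad≡1+m = I₂ , i , b , j , refl , cong ∣_∣ ad≡1+m , sym (⊗-identityˡ _)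
positive-diagonal -[1+ i ] b -[1+ j ] ad≡1+m =
  mat (- + 1) (+ 0) (+ 0) (- + 1) , i , - b , j , refl , cong ∣_∣ ad≡1+m ,
  mat-cong (entry₁ (+ suc i)) (entry₂ b (+ suc j)) (entry₃ (+ suc i)) (entry₄ b (+ suc j))
  where
  entry₁ : ∀ x → - x ≡ - + 1 * x + + 0 * + 0
  entry₁ = solve-∀
  entry₂ : ∀ b y → b ≡ - + 1 * (- b) + + 0 * y
  entry₂ = solve-∀
  entry₃ : ∀ x → + 0 ≡ + 0 * x + (- + 1) * + 0
  entry₃ = solve-∀
  entry₄ : ∀ b y → - y ≡ + 0 * (- b) + (- + 1) * y
  entry₄ = solve-∀
positive-diagonal +[1+ i ] b -[1+ j ] ()
positive-diagonal -[1+ i ] b +[1+ j ] ()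

positive-triangularise : ∀ {m} A → det A ≡ + suc m → PositiveUpperTriangular (suc m) A
positive-triangularise A detA≡1+m with triangularise (suc ∣ c A ∣) A (NP.n<1+n _)
... | σ , mat a b .(+ 0) d , detσ≡1 , refl , A≡σT
  with τ , i , b' , j , detτ≡1 , ij≡1+m , T≡τT' ← positive-diagonal a b d
         (trans (sym (det-upper a b d))
                (trans (sym (det-⊗-SL2Zˡ σ _ detσ≡1)) (trans (cong det (sym A≡σT)) detA≡1+m)))
  = σ ⊗ τ , i , b' , j , SL2Z-⊗ σ τ detσ≡1 detτ≡1 , ij≡1+m ,
    trans A≡σT (trans (cong (σ ⊗_) T≡τT') (sym (⊗-assoc σ τ _)))

reduce-upper-right : ∀ a b j → mat a b (+ 0) (+ suc j) ≡
  mat (+ 1) (b /ℕ suc j) (+ 0) (+ 1) ⊗ mat a (+ (b %ℕ suc j)) (+ 0) (+ suc j)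
reduce-upper-right a b j = mat-cong (entry₁ a (b /ℕ suc j))
  (trans (a≡a%ℕn+[a/ℕn]*n b (suc j)) (entry₂ (+ (b %ℕ suc j)) (b /ℕ suc j) (+ suc j)))
  (entry₃ a) (entry₄ (+ (b %ℕ suc j)) (+ suc j))
  where
  entry₁ : ∀ a q → a ≡ + 1 * a + q * + 0
  entry₁ = solve-∀
  entry₂ : ∀ r q d → r + q * d ≡ + 1 * r + q * d
  entry₂ = solve-∀
  entry₃ : ∀ a → + 0 ≡ + 0 * a + + 1 * + 0
  entry₃ = solve-∀
  entry₄ : ∀ r d → d ≡ + 0 * r + + 1 * d
  entry₄ = solve-∀

hermite : ∀ {m} → 1 ≤ m → ∀ A → det A ≡ + m → ∃[ σ ] ∃[ H ] (SL2Z σ × H ∈ box (suc m) × A ≡ σ ⊗ H)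
hermite {suc m} _ A detA≡m with σ , i , b , j , detσ≡1 , ij≡m , A≡σT ← positive-triangularise A detA≡m =
  σ ⊗ U , H , SL2Z-⊗ σ U detσ≡1 (detU≡1 q) , H∈box ,
  trans A≡σT (trans (cong (σ ⊗_) (reduce-upper-right (+ suc i) b j)) (sym (⊗-assoc σ U H)))
  where
  q = b /ℕ suc j
  U = mat (+ 1) q (+ 0) (+ 1)
  H = mat (+ suc i) (+ (b %ℕ suc j)) (+ 0) (+ suc j)
  detU≡1 : ∀ q → + 1 * + 1 - q * + 0 ≡ + 1
  detU≡1 = solve-∀
  1+i≤1+m : suc i ℕ.≤ suc m
  1+i≤1+m = subst (suc i ℕ.≤_) ij≡m (NP.m≤m*n (suc i) (suc j))
  1+j≤1+m : suc j ℕ.≤ suc m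
  1+j≤1+m = subst (suc j ℕ.≤_) ij≡m (NP.m≤n*m (suc j) (suc i))
  H∈box : H ∈ box (suc (suc m))
  H∈box = ∈-box (ℕ.s≤s 1+i≤1+m) (NP.<-≤-trans (n%ℕd<d b (suc j)) (NP.m≤n⇒m≤1+n 1+j≤1+m))
                (ℕ.s≤s ℕ.z≤n) (ℕ.s≤s 1+j≤1+m)

module Finiteness {N : ℕ} (N≥1 : 1 ≤ N) {G : Mat → Set} (G-subgroup : IsSubgroupGL2 N G)
                  {n : ℕ} (n≥1 : 1 ≤ n) {δn : Mat} (δn∈G : G δn) (det-δn : det δn ≡[ N ] + n)
                  {s : Mat → Mat} (s-section : IsSection N G s) where
  open Congruence N
  open Subgroup G-subgroup
  open Section G-subgroup s-section
  open IsSubgroupGL2 G-subgroup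
  open IsSection s-section

  instance
    N-nonZero : ℕ.NonZero N
    N-nonZero = ℕ.>-nonZero N≥1

  reduce : Mat → Mat
  reduce (mat a b c d) = mat (+ (a %ℕ N)) (+ (b %ℕ N)) (+ (c %ℕ N)) (+ (d %ℕ N))

  reduce-∈ : ∀ A → reduce A ∈ box N
  reduce-∈ (mat a b c d) = ∈-box (n%ℕd<d a N) (n%ℕd<d b N) (n%ℕd<d c N) (n%ℕd<d d N)

  reduce-≈ : ∀ A → A ≈ᴹ reduce A
  reduce-≈ (mat a b c d) = mat≈ (≈-%ℕ a) (≈-%ℕ b) (≈-%ℕ c) (≈-%ℕ d)

  Γ Δ : Mat → Set
  Γ = ΓG N G
  Δ = Δn N G n

  det-δn≈n : det δn ≈ + n
  det-δn≈n = ⟦ det-δn ⟧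

  δn⁻¹ : Mat
  δn⁻¹ = proj₁ (closed-inv δn∈G)

  δn⁻¹∈G : G δn⁻¹
  δn⁻¹∈G = proj₁ (proj₂ (closed-inv δn∈G))

  det-⊗-δn⁻¹ : ∀ y → det y ≡ + n → det (y ⊗ δn⁻¹) ≈ + 1
  det-⊗-δn⁻¹ y detY≡n = begin
    det (y ⊗ δn⁻¹)          ≡⟨ det-⊗ y δn⁻¹ ⟩
    det y * det δn⁻¹        ≈⟨ *-cong (≈-trans (≈-reflexive detY≡n) (≈-sym det-δn≈n)) (≈-refl {det δn⁻¹}) ⟩
    det δn * det δn⁻¹       ≡⟨ sym (det-⊗ δn δn⁻¹) ⟩
    det (δn ⊗ δn⁻¹)         ≈⟨ det-cong (≡M⇒≈ᴹ {δn ⊗ δn⁻¹} {I₂} (proj₂ (proj₂ (closed-inv δn∈G)))) ⟩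
    + 1                     ∎
    where open Relation.Binary.Reasoning.Setoid ≈-setoid

  -- for det y = n, y ∈ G iff y δₙ⁻¹ ∈ G₀, and G₀ is decidable
  Δ? : ∀ y → Dec (Δ y)
  Δ? y with det y ℤ.≟ + n
  ... | no detY≢n = no (detY≢n ∘ proj₁)
  ... | yes detY≡n = map′ (λ (y⊗δn⁻¹∈G , _) → detY≡n , G-cancelʳ δn⁻¹∈G y⊗δn⁻¹∈G)
                          (λ (_ , y∈G) → closed-mul y∈G δn⁻¹∈G , congruent (det-⊗-δn⁻¹ y detY≡n))
                          (G₀? (y ⊗ δn⁻¹))

  candidates : List Mat
  candidates = cartesianProductWith (λ x H → s x ⊗ H) (box N) (box (suc n))

  representatives : List Mat
  representatives = filter Δ? candidates

  representatives-⊆-Δ : ∀ δ → δ ∈ representatives → Δ δ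
  representatives-⊆-Δ δ δ∈reps = proj₂ (∈-filter⁻ Δ? {xs = candidates} δ∈reps)

  Δ-translate : ∀ σ t H → SL2Z σ → SL2Z t → G (t ⊗ adj σ) → Δ (σ ⊗ H) → Δ (t ⊗ H)
  Δ-translate σ t H detσ≡1 dett≡1 t⊗adjσ∈G (detσH≡n , σH∈G) =
    trans (det-⊗-SL2Zˡ t H dett≡1) (trans (sym (det-⊗-SL2Zˡ σ H detσ≡1)) detσH≡n) ,
    subst G translate (closed-mul t⊗adjσ∈G σH∈G)
    where
    translate : (t ⊗ adj σ) ⊗ (σ ⊗ H) ≡ t ⊗ H
    translate = begin
      (t ⊗ adj σ) ⊗ (σ ⊗ H)    ≡⟨ adj-sandwich t σ H ⟩
      scale (det σ) (t ⊗ H)    ≡⟨ cong (λ k → scale k (t ⊗ H)) detσ≡1 ⟩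
      scale (+ 1) (t ⊗ H)      ≡⟨ scale-identity (t ⊗ H) ⟩
      t ⊗ H                    ∎
      where open ≡-Reasoning

  Δ-covered : ∀ δ → Δ δ → ∃[ γ ] ∃[ δ' ] (Γ γ × δ' ∈ representatives × δ ≡ γ ⊗ δ')
  Δ-covered δ δ∈Δ with σ , H , detσ≡1 , H∈box , refl ← hermite n≥1 δ (proj₁ δ∈Δ) =
    σ ⊗ adj t , t ⊗ H , Γ-σ⊗adjt , t⊗H∈reps , σH≡σ⊗adjt⊗tH
    where
    x = reduce σ
    x∈SL : SLN N x
    x∈SL = congruent (≈-trans (≈-sym (det-cong (reduce-≈ σ))) (≈-reflexive detσ≡1))
    t = s x
    dett≡1 : SL2Z t
    dett≡1 = into-SL2Z x x∈SL
    t⊗adjσ∈G₀ : G₀ N G (t ⊗ adj σ)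
    t⊗adjσ∈G₀ = G₀-resp (⊗-congʳ t (adj-cong (≈ᴹ-sym (reduce-≈ σ)))) (s⊗adj∈G₀ x∈SL)
    Γ-σ⊗adjt : Γ (σ ⊗ adj t)
    Γ-σ⊗adjt = SL2Z-⊗ σ (adj t) detσ≡1 (SL2Z-adj t dett≡1) ,
               subst (G₀ N G) (adj-⊗-adj t σ) (G₀-adj t⊗adjσ∈G₀)
    t⊗H∈reps : t ⊗ H ∈ representatives
    t⊗H∈reps = ∈-filter⁺ Δ? (∈-cartesianProductWith⁺ (λ y H' → s y ⊗ H') (reduce-∈ σ) H∈box)
                          (Δ-translate σ t H detσ≡1 dett≡1 (proj₁ t⊗adjσ∈G₀) δ∈Δ)
    σH≡σ⊗adjt⊗tH : σ ⊗ H ≡ (σ ⊗ adj t) ⊗ (t ⊗ H)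
    σH≡σ⊗adjt⊗tH = begin
      σ ⊗ H                        ≡⟨ sym (scale-identity (σ ⊗ H)) ⟩
      scale (+ 1) (σ ⊗ H)          ≡⟨ cong (λ k → scale k (σ ⊗ H)) (sym dett≡1) ⟩
      scale (det t) (σ ⊗ H)        ≡⟨ sym (adj-sandwich σ t H) ⟩
      (σ ⊗ adj t) ⊗ (t ⊗ H)        ∎
      where open ≡-Reasoning

mainTheorem13 : (N : ℕ) → 1 ≤ N → (G : Mat → Set) → IsSubgroupGL2 N G →
                (n : ℕ) → 1 ≤ n →
                (δn : Mat) → G δn → det δn ≡[ N ] + n →
                (ninv : ℤ) → (+ n) * ninv ≡[ N ] + 1 →
                (s : Mat → Mat) → IsSection N G s →
                MerelPair (ΓG N G) (Δn N G n) (φn s δn ninv)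
mainTheorem13 N N≥1 G G-subgroup n n≥1 δn δn∈G det-δn ninv ninv-inverse s s-section = record
  { Δ-invertible = λ δ (detδ≡n , _) detδ≡0 → NP.>⇒≢ n≥1 (ℤ.+-injective (trans (sym detδ≡n) detδ≡0))
  ; ΓΔ⊆ΔΓ        = ΓΔ⊆ΔΓ
  ; ΔΓ⊆ΓΔ        = ΔΓ⊆ΓΔ
  ; finite       = representatives , representatives-⊆-Δ , Δ-covered
  ; φ-SL2Z       = λ γ → φ-SL2Z γ ∘ det-Δ̃SL
  ; cond1        = φ-equivariant
  ; cond2        = γ⊗adjφ∈Δ̃
  ; cond3        = adj-Γ-injective
  }
  where
  open MerelConditions G-subgroup δn∈G det-δn ninv-inverse s-section
  open Finiteness N≥1 G-subgroup n≥1 δn∈G det-δn s-section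
    using (representatives; representatives-⊆-Δ; Δ-covered)
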